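{- Let $\mathcal{P}$ be a finite bounded poset with $n$ elements such that the $m$-cover poset $\mathcal{P}^{\langle m\rangle}$ is a lattice for all integers $m>0$. If $n>1$, then for every $m>0$, $$\bigl\lvert\mathcal{P}^{\langle m\rangle}\bigr\rvert=n\binom{m+1}{2}-m^{2}+1.$$
   Context: For a finite bounded poset $\mathcal{P}$ with least element $\hat0$ and $m>0$, the $m$-cover poset $\mathcal{P}^{\langle m\rangle}$ is the subposet of the componentwise-ordered direct product $\mathcal{P}^m$ consisting of the multichains $x_1\le\cdots\le x_m$ of $\mathcal P$ such that $\{x_1,\dots,x_m\}\setminus\{\hat0\}$ is empty, a single element, or a two-element set $\{p,q\}$ with $p\lessdot q$. -}

module Defs where

open import Level using (0ℓ)
open import Data.Nat using (ℕ)
open import Data.Fin using (Fin)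
open import Data.Vec using (Vec; lookup)
open import Data.List using (List)
open import Data.List.Membership.Propositional using (_∈_)
open import Data.List.Relation.Unary.Unique.Propositional using (Unique)
open import Data.Product using (Σ; ∃; ∃₂; _×_)
open import Data.Sum using (_⊎_)
open import Relation.Binary using (Rel; IsPartialOrder; Decidable)
open import Relation.Binary.PropositionalEquality using (_≡_; _≢_)
open import Function.Bundles using (_⇔_)

record FinPoset (n : ℕ) : Set₁ where
  field
    _≤_            : Rel (Fin n) 0ℓ
    isPartialOrder : IsPartialOrder _≡_ _≤_
    _≤?_           : Decidable _≤_

  _<_ : Rel (Fin n) 0ℓ
  p < q = (p ≤ q) × (p ≢ q)

  _⋖_ : Rel (Fin n) 0ℓ
  p ⋖ q = (p < q) × (∀ z → p ≤ z → z ≤ q → (z ≡ p) ⊎ (z ≡ q))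

record IsBounded {n : ℕ} (P : FinPoset n) : Set where
  open FinPoset P
  field
    0̂      : Fin n
    1̂      : Fin n
    0̂-least : ∀ x → 0̂ ≤ x
    1̂-great : ∀ x → x ≤ 1̂

module CoverPoset {n : ℕ} (P : FinPoset n) (B : IsBounded P) (m : ℕ) where
  open FinPoset P
  open IsBounded B

  IsMultichain : Vec (Fin n) m → Set
  IsMultichain v = ∀ (i j : Fin m) → i Data.Fin.≤ j → lookup v i ≤ lookup v j

  Occurs : Fin n → Vec (Fin n) m → Set
  Occurs a v = ∃ λ i → lookup v i ≡ a

  -- {x₁,…,xₘ} ∖ {0̂} is empty, a singleton {p}, or {p,q} with p ⋖ q
  NonzeroSetEmpty : Vec (Fin n) m → Set
  NonzeroSetEmpty v = ∀ i → lookup v i ≡ 0̂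

  NonzeroSetSingleton : Vec (Fin n) m → Set
  NonzeroSetSingleton v =
    ∃ λ p → (p ≢ 0̂) × Occurs p v × (∀ i → (lookup v i ≡ 0̂) ⊎ (lookup v i ≡ p))

  NonzeroSetCoverPair : Vec (Fin n) m → Set
  NonzeroSetCoverPair v =
    ∃₂ λ p q → (p ⋖ q) × (p ≢ 0̂) × (q ≢ 0̂) × Occurs p v × Occurs q v ×
      (∀ i → (lookup v i ≡ 0̂) ⊎ (lookup v i ≡ p) ⊎ (lookup v i ≡ q))

  InCover : Vec (Fin n) m → Set
  InCover v = IsMultichain v ×
    (NonzeroSetEmpty v ⊎ NonzeroSetSingleton v ⊎ NonzeroSetCoverPair v)

  _≤ᶜ_ : Vec (Fin n) m → Vec (Fin n) m → Set
  u ≤ᶜ v = ∀ i → lookup u i ≤ lookup v i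

  IsJoin : Vec (Fin n) m → Vec (Fin n) m → Vec (Fin n) m → Set
  IsJoin a b c = InCover c × a ≤ᶜ c × b ≤ᶜ c ×
    (∀ d → InCover d → a ≤ᶜ d → b ≤ᶜ d → c ≤ᶜ d)

  IsMeet : Vec (Fin n) m → Vec (Fin n) m → Vec (Fin n) m → Set
  IsMeet a b c = InCover c × c ≤ᶜ a × c ≤ᶜ b ×
    (∀ d → InCover d → d ≤ᶜ a → d ≤ᶜ b → d ≤ᶜ c)

  IsLattice : Set
  IsLattice = ∀ a b → InCover a → InCover b →
    (∃ λ c → IsJoin a b c) × (∃ λ c → IsMeet a b c)

  HasCardinality : ℕ → Set
  HasCardinality k = ∃ λ (xs : List (Vec (Fin n) m)) →
    Unique xs × (∀ v → (v ∈ xs) ⇔ InCover v) × (Data.List.length xs ≡ k)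

-- If P^⟨2⟩ is a lattice, no p ≠ 0̂ has two upper covers q₁ ≠ q₂.  The join (c₁, c₂) of
-- (p, q₁) and (p, q₂) has q₁, q₂ < c₂, so it lies below (xᵢ, c₂) for lower covers xᵢ ⋖ c₂
-- with qᵢ ≤ xᵢ; this forces c₁ ⋖ c₂ and x₁ = x₂ = c₁, and then (c₁, c₁) is a smaller upper
-- bound.  As every p ∉ {0̂, 1̂} has an upper cover, there are exactly n − 2 relations p ⋖ q
-- with p ≠ 0̂.  An element of P^⟨m+1⟩ is either 0̂ followed by an element of P^⟨m⟩, or a
-- chain p^a q^b with p ≠ 0̂, a ≥ 1 and p ⋖ q.  Such a chain of length m + 1 either repeats
-- its first entry or is p q^m, so their number s(m) satisfies s(1) = n − 1 and
-- s(m + 1) = s(m) + n − 2; summing, |P^⟨m⟩| = 1 + m + (n − 2) C(m + 1, 2).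
module Submission where

open import Defs
open import Data.Empty using (⊥; ⊥-elim)
open import Data.Fin using (Fin; zero; suc; _≟_; punchIn; punchOut)
open import Data.Fin.Induction using (po-wellFounded; po-noetherian)
open import Data.Fin.Properties
  using (any?; 0≢1+n; punchIn-injective; punchInᵢ≢i; punchIn-punchOut)
open import Data.List using (List; []; _∷_; _++_; length; allFin)
open import Data.List.Properties using (length-map; length-++; length-tabulate)
open import Data.List.Membership.Propositional using (_∈_)
open import Data.List.Membership.Propositional.Properties
  using (∈-map⁺; ∈-map⁻; ∈-++⁺ˡ; ∈-++⁺ʳ; ∈-++⁻; ∈-allFin)
open import Data.List.Relation.Unary.All using ([])
open import Data.List.Relation.Unary.AllPairs using ([]; _∷_)
open import Data.List.Relation.Unary.Any using (here; there)
open import Data.List.Relation.Unary.Unique.Propositional using (Unique)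
open import Data.List.Relation.Unary.Unique.Propositional.Properties using (map⁺; ++⁺; allFin⁺)
open import Data.Nat using (ℕ; zero; suc; _+_; _*_; _^_; z≤n; s≤s)
open import Data.Nat.Combinatorics using (_C_; nC1≡n; nCk+nC[k+1]≡[n+1]C[k+1])
open import Data.Nat.Properties using (+-comm)
open import Data.Nat.Tactic.RingSolver using (solve-∀)
open import Data.Product using (∃; _×_; _,_; proj₁; proj₂)
open import Data.Sum using (_⊎_; inj₁; inj₂; fromInj₂)
open import Data.Unit using (⊤; tt)
open import Data.Vec using (Vec; []; _∷_; lookup; replicate)
open import Data.Vec.Properties using (∷-injectiveˡ; ∷-injectiveʳ; lookup-replicate)
open import Function using (_∘_; flip)
open import Function.Bundles using (_⇔_; mk⇔; Equivalence)
open import Induction.WellFounded using (Acc; acc)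
open import Relation.Binary using (IsPartialOrder; Decidable)
open import Relation.Binary.Construct.NonStrictToStrict using (<-decidable)
open import Relation.Binary.PropositionalEquality
  using (_≡_; _≢_; refl; sym; trans; cong; cong₂; subst; subst₂; module ≡-Reasoning)
open import Relation.Nullary using (¬_; yes; no)
open import Relation.Nullary.Decidable using (_×-dec_)

open Equivalence using (to; from)

resolveʳ : {A B : Set} → ¬ A → A ⊎ B → B
resolveʳ ¬a = fromInj₂ (⊥-elim ∘ ¬a)

-- CoverPoset.HasCardinality P B m k unfolds to Card (CoverPoset.InCover P B m) k.
Card : {X : Set} → (X → Set) → ℕ → Set
Card {X} A k = ∃ λ (xs : List X) → Unique xs × (∀ x → (x ∈ xs) ⇔ A x) × (length xs ≡ k)

module _ {X : Set} where

  card-resp : {A B : X → Set} {k : ℕ} → (∀ x → A x ⇔ B x) → Card A k → Card B k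
  card-resp A⇔B (xs , unique , ∈⇔A , len) =
    xs , unique ,
    (λ x → mk⇔ (to (A⇔B x) ∘ to (∈⇔A x)) (from (∈⇔A x) ∘ from (A⇔B x))) ,
    len

  card-singleton : (x : X) → Card (_≡ x) 1
  card-singleton x =
    x ∷ [] , [] ∷ [] , (λ y → mk⇔ (λ { (here y≡x) → y≡x ; (there ()) }) here) , refl

  card-⊎ : {A B : X → Set} {a b : ℕ} → (∀ x → A x → B x → ⊥) →
           Card A a → Card B b → Card (λ x → A x ⊎ B x) (a + b)
  card-⊎ disjoint (xs , xs-unique , ∈xs⇔A , xs-len) (ys , ys-unique , ∈ys⇔B , ys-len) =
    xs ++ ys ,
    ++⁺ xs-unique ys-unique (λ (∈xs , ∈ys) → disjoint _ (to (∈xs⇔A _) ∈xs) (to (∈ys⇔B _) ∈ys)) ,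
    (λ x → mk⇔ (Data.Sum.map (to (∈xs⇔A x)) (to (∈ys⇔B x)) ∘ ∈-++⁻ xs)
               (λ { (inj₁ ax) → ∈-++⁺ˡ (from (∈xs⇔A x) ax)
                  ; (inj₂ bx) → ∈-++⁺ʳ xs (from (∈ys⇔B x) bx) })) ,
    trans (length-++ xs) (cong₂ _+_ xs-len ys-len)

  card-image : {Y : Set} {A : X → Set} {a : ℕ} (f : X → Y) →
               (∀ {x y} → f x ≡ f y → x ≡ y) → Card A a → Card (λ y → ∃ λ x → A x × f x ≡ y) a
  card-image f f-injective (xs , unique , ∈⇔A , len) =
    Data.List.map f xs , map⁺ f-injective unique ,
    (λ y → mk⇔ (λ ∈fxs → let (x , x∈xs , y≡fx) = ∈-map⁻ f ∈fxs in x , to (∈⇔A x) x∈xs , sym y≡fx)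
               (λ { (x , ax , refl) → ∈-map⁺ f (from (∈⇔A x) ax) })) ,
    trans (length-map f xs) len

card-Fin : ∀ k → Card (λ (_ : Fin k) → ⊤) k
card-Fin k = allFin k , allFin⁺ k , (λ i → mk⇔ (λ _ → tt) (λ _ → ∈-allFin i)) , length-tabulate _

module _ {k : ℕ} {a b : Fin (suc (suc k))} (a≢b : a ≢ b) where

  punchIn₂ : Fin k → Fin (suc (suc k))
  punchIn₂ j = punchIn a (punchIn (punchOut a≢b) j)

  punchIn₂-injective : ∀ {i j} → punchIn₂ i ≡ punchIn₂ j → i ≡ j
  punchIn₂-injective = punchIn-injective _ _ _ ∘ punchIn-injective a _ _

  punchIn₂≢a : ∀ j → punchIn₂ j ≢ a
  punchIn₂≢a j = punchInᵢ≢i a _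

  punchIn₂≢b : ∀ j → punchIn₂ j ≢ b
  punchIn₂≢b j punchIn₂j≡b =
    punchInᵢ≢i _ j (punchIn-injective a _ _ (trans punchIn₂j≡b (sym (punchIn-punchOut a≢b))))

  punchIn₂-surjective : ∀ {x} → x ≢ a → x ≢ b → ∃ λ j → punchIn₂ j ≡ x
  punchIn₂-surjective x≢a x≢b =
    punchOut b′≢x′ , trans (cong (punchIn a) (punchIn-punchOut b′≢x′)) (punchIn-punchOut a≢x)
    where
      a≢x = x≢a ∘ sym
      b′≢x′ : punchOut a≢b ≢ punchOut a≢x
      b′≢x′ b′≡x′ = x≢b (trans (sym (punchIn-punchOut a≢x))
                           (trans (cong (punchIn a) (sym b′≡x′)) (punchIn-punchOut a≢b)))

module FinPosetCovers {n : ℕ} (P : FinPoset n) where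
  open FinPoset P
  private module ≤ = IsPartialOrder isPartialOrder

  ⋖⇒≱ : ∀ {p q} → p ⋖ q → ¬ q ≤ p
  ⋖⇒≱ ((p≤q , p≢q) , _) q≤p = p≢q (≤.antisym p≤q q≤p)

  ⋖-comparable⇒≡ : ∀ {p q₁ q₂} → p ⋖ q₁ → p ⋖ q₂ → q₂ ≤ q₁ → q₂ ≡ q₁
  ⋖-comparable⇒≡ (_ , between) ((p≤q₂ , p≢q₂) , _) q₂≤q₁ =
    resolveʳ (p≢q₂ ∘ sym) (between _ p≤q₂ q₂≤q₁)

  _<?_ : Decidable _<_
  _<?_ = <-decidable _≡_ _≤_ _≟_ _≤?_

  ⋖-or-between : ∀ {a b} → a < b → a ⋖ b ⊎ ∃ λ z → a < z × z < b
  ⋖-or-between {a} {b} a<b with any? (λ z → (a <? z) ×-dec (z <? b))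
  ... | yes between = inj₂ between
  ... | no ¬between = inj₁ (a<b , onlyEnds)
    where
      onlyEnds : ∀ z → a ≤ z → z ≤ b → z ≡ a ⊎ z ≡ b
      onlyEnds z a≤z z≤b with z ≟ a | z ≟ b
      ... | yes z≡a | _       = inj₁ z≡a
      ... | no _    | yes z≡b = inj₂ z≡b
      ... | no z≢a  | no z≢b  = ⊥-elim (¬between (z , (a≤z , z≢a ∘ sym) , (z≤b , z≢b)))

  ∃-upper-cover : ∀ {a b} → a < b → ∃ λ c → a ⋖ c × c ≤ b
  ∃-upper-cover {b = b} = go (po-wellFounded isPartialOrder b)
    where
      go : ∀ {a b} → Acc _<_ b → a < b → ∃ λ c → a ⋖ c × c ≤ b
      go (acc below) a<b with ⋖-or-between a<b
      ... | inj₁ a⋖b = _ , a⋖b , ≤.refl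
      ... | inj₂ (z , a<z , z<b) with go (below z<b) a<z
      ...   | c , a⋖c , c≤z = c , a⋖c , ≤.trans c≤z (proj₁ z<b)

  ∃-lower-cover : ∀ {a b} → a < b → ∃ λ c → a ≤ c × c ⋖ b
  ∃-lower-cover {a} = go (po-noetherian isPartialOrder a)
    where
      go : ∀ {a b} → Acc (flip _<_) a → a < b → ∃ λ c → a ≤ c × c ⋖ b
      go (acc above) a<b with ⋖-or-between a<b
      ... | inj₁ a⋖b = _ , ≤.refl , a⋖b
      ... | inj₂ (z , a<z , z<b) with go (above a<z) z<b
      ...   | c , z≤c , c⋖b = c , ≤.trans (proj₁ a<z) z≤c , c⋖b

module CoverPosetShape {n : ℕ} (P : FinPoset n) (B : IsBounded P) where
  open FinPoset P
  open IsBounded B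
  open FinPosetCovers P
  private
    open module CP {m : ℕ} = CoverPoset P B m
      using ( IsMultichain; Occurs; NonzeroSetEmpty; NonzeroSetSingleton; NonzeroSetCoverPair
            ; InCover; IsJoin; IsLattice)
    module ≤ = IsPartialOrder isPartialOrder

  ≤0̂⇒≡0̂ : ∀ {x} → x ≤ 0̂ → x ≡ 0̂
  ≤0̂⇒≡0̂ {x} x≤0̂ = ≤.antisym x≤0̂ (0̂-least x)

  ≢0̂-upward : ∀ {x y} → x ≢ 0̂ → x ≤ y → y ≢ 0̂
  ≢0̂-upward x≢0̂ x≤y refl = x≢0̂ (≤0̂⇒≡0̂ x≤y)

  ⋖⇒≢1̂ : ∀ {p q} → p ⋖ q → p ≢ 1̂
  ⋖⇒≢1̂ {q = q} p⋖q refl = ⋖⇒≱ p⋖q (1̂-great q)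

  multichain-∷⁺ : ∀ {m x} {w : Vec (Fin n) m} →
                  (∀ i → x ≤ lookup w i) → IsMultichain w → IsMultichain (x ∷ w)
  multichain-∷⁺ x≤w mc zero    zero    _         = ≤.refl
  multichain-∷⁺ x≤w mc zero    (suc j) _         = x≤w j
  multichain-∷⁺ x≤w mc (suc i) (suc j) (s≤s i≤j) = mc i j i≤j

  multichain-head : ∀ {m x} {w : Vec (Fin n) m} → IsMultichain (x ∷ w) → ∀ i → x ≤ lookup w i
  multichain-head mc i = mc zero (suc i) z≤n

  multichain-tail : ∀ {m x} {w : Vec (Fin n) m} → IsMultichain (x ∷ w) → IsMultichain w
  multichain-tail mc i j i≤j = mc (suc i) (suc j) (s≤s i≤j)

  multichain-replicate : ∀ {m} y → IsMultichain (replicate m y)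
  multichain-replicate y i j _ =
    subst₂ _≤_ (sym (lookup-replicate i y)) (sym (lookup-replicate j y)) ≤.refl

  SmallNonzeroSet : ∀ {m} → Vec (Fin n) m → Set
  SmallNonzeroSet v = NonzeroSetEmpty v ⊎ NonzeroSetSingleton v ⊎ NonzeroSetCoverPair v

  occurs-0̂∷ : ∀ {m p} {w : Vec (Fin n) m} → p ≢ 0̂ → Occurs p (0̂ ∷ w) → Occurs p w
  occurs-0̂∷ p≢0̂ (zero  , 0̂≡p) = ⊥-elim (p≢0̂ (sym 0̂≡p))
  occurs-0̂∷ p≢0̂ (suc i , wᵢ≡p) = i , wᵢ≡p

  smallNonzeroSet-0̂∷ : ∀ {m} {w : Vec (Fin n) m} → SmallNonzeroSet (0̂ ∷ w) ⇔ SmallNonzeroSet w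
  smallNonzeroSet-0̂∷ = mk⇔ drop0̂ add0̂
    where
      drop0̂ : ∀ {m} {w : Vec (Fin n) m} → SmallNonzeroSet (0̂ ∷ w) → SmallNonzeroSet w
      drop0̂ (inj₁ zeros) = inj₁ (zeros ∘ suc)
      drop0̂ (inj₂ (inj₁ (p , p≢0̂ , p∈ , values))) =
        inj₂ (inj₁ (p , p≢0̂ , occurs-0̂∷ p≢0̂ p∈ , values ∘ suc))
      drop0̂ (inj₂ (inj₂ (p , q , p⋖q , p≢0̂ , q≢0̂ , p∈ , q∈ , values))) =
        inj₂ (inj₂ (p , q , p⋖q , p≢0̂ , q≢0̂ , occurs-0̂∷ p≢0̂ p∈ , occurs-0̂∷ q≢0̂ q∈ ,
                    values ∘ suc))

      add0̂ : ∀ {m} {w : Vec (Fin n) m} → SmallNonzeroSet w → SmallNonzeroSet (0̂ ∷ w)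
      add0̂ (inj₁ zeros) = inj₁ λ { zero → refl ; (suc i) → zeros i }
      add0̂ (inj₂ (inj₁ (p , p≢0̂ , (i , wᵢ≡p) , values))) =
        inj₂ (inj₁ (p , p≢0̂ , (suc i , wᵢ≡p) , λ { zero → inj₁ refl ; (suc i) → values i }))
      add0̂ (inj₂ (inj₂ (p , q , p⋖q , p≢0̂ , q≢0̂ , (i , wᵢ≡p) , (j , wⱼ≡q) , values))) =
        inj₂ (inj₂ (p , q , p⋖q , p≢0̂ , q≢0̂ , (suc i , wᵢ≡p) , (suc j , wⱼ≡q) ,
                    λ { zero → inj₁ refl ; (suc i) → values i }))

  inCover-0̂∷ : ∀ {m} {w : Vec (Fin n) m} → InCover (0̂ ∷ w) ⇔ InCover w
  inCover-0̂∷ = mk⇔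
    (λ (mc , small) → multichain-tail mc , to smallNonzeroSet-0̂∷ small)
    (λ (mc , small) → multichain-∷⁺ (λ _ → 0̂-least _) mc , from smallNonzeroSet-0̂∷ small)

  -- CoverTail p w: w = p^a q^b for some a, b ≥ 0 and some upper cover q of p.
  CoverTail : ∀ {m} → Fin n → Vec (Fin n) m → Set
  CoverTail p []      = ⊤
  CoverTail p (y ∷ w) = (y ≡ p × CoverTail p w) ⊎ (p ⋖ y × w ≡ replicate _ y)

  coverTail⇒multichain : ∀ {m p} {w : Vec (Fin n) m} → CoverTail p w → IsMultichain (p ∷ w)
  coverTail⇒multichain {w = []} _ = multichain-∷⁺ (λ ()) (λ ())
  coverTail⇒multichain {w = y ∷ w} (inj₁ (refl , tail)) =
    multichain-∷⁺ (λ { zero → ≤.refl ; (suc i) → multichain-head mc i }) mc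
    where mc = coverTail⇒multichain tail
  coverTail⇒multichain {w = y ∷ w} (inj₂ (((p≤y , _) , _) , refl)) =
    multichain-∷⁺ (λ i → subst (_ ≤_) (sym (lookup-replicate i y)) p≤y) (multichain-replicate y)

  coverTail-values : ∀ {m p} {w : Vec (Fin n) m} → CoverTail p w →
    (∀ i → lookup w i ≡ p) ⊎
    (∃ λ q → p ⋖ q × Occurs q w × (∀ i → lookup w i ≡ p ⊎ lookup w i ≡ q))
  coverTail-values {w = []} _ = inj₁ λ ()
  coverTail-values {w = y ∷ w} (inj₁ (refl , tail)) with coverTail-values tail
  ... | inj₁ all-p = inj₁ λ { zero → refl ; (suc i) → all-p i }
  ... | inj₂ (q , p⋖q , (i , wᵢ≡q) , values) =
    inj₂ (q , p⋖q , (suc i , wᵢ≡q) , λ { zero → inj₁ refl ; (suc i) → values i })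
  coverTail-values {w = y ∷ w} (inj₂ (p⋖y , refl)) =
    inj₂ (y , p⋖y , (zero , refl) , λ i → inj₂ (lookup-replicate i y))

  coverTail⇒inCover : ∀ {m x} {w : Vec (Fin n) m} → x ≢ 0̂ → CoverTail x w → InCover (x ∷ w)
  coverTail⇒inCover {x = x} x≢0̂ tail with coverTail-values tail
  ... | inj₁ all-x =
    coverTail⇒multichain tail ,
    inj₂ (inj₁ (x , x≢0̂ , (zero , refl) , λ { zero → inj₂ refl ; (suc i) → inj₂ (all-x i) }))
  ... | inj₂ (q , x⋖q , (i , wᵢ≡q) , values) =
    coverTail⇒multichain tail ,
    inj₂ (inj₂ (x , q , x⋖q , x≢0̂ , ≢0̂-upward x≢0̂ (proj₁ (proj₁ x⋖q)) ,
                (zero , refl) , (suc i , wᵢ≡q) ,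
                λ { zero → inj₂ (inj₁ refl) ; (suc i) → inj₂ (values i) }))

  constant⇒≡replicate : ∀ {m q} {w : Vec (Fin n) m} → (∀ i → lookup w i ≡ q) → w ≡ replicate m q
  constant⇒≡replicate {w = []}    _     = refl
  constant⇒≡replicate {w = y ∷ w} all-q =
    cong₂ _∷_ (all-q zero) (constant⇒≡replicate (all-q ∘ suc))

  constant⇒coverTail : ∀ {m p} {w : Vec (Fin n) m} → (∀ i → lookup w i ≡ p) → CoverTail p w
  constant⇒coverTail {w = []}    _     = tt
  constant⇒coverTail {w = y ∷ w} all-p = inj₁ (all-p zero , constant⇒coverTail (all-p ∘ suc))

  twoValued⇒coverTail : ∀ {m p q} {w : Vec (Fin n) m} → p ⋖ q → IsMultichain (p ∷ w) →
                        (∀ i → lookup w i ≡ p ⊎ lookup w i ≡ q) → CoverTail p w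
  twoValued⇒coverTail {w = []} _ _ _ = tt
  twoValued⇒coverTail {w = y ∷ w} p⋖q mc values with values zero
  ... | inj₁ refl = inj₁ (refl , twoValued⇒coverTail p⋖q (multichain-tail mc) (values ∘ suc))
  ... | inj₂ refl = inj₂ (p⋖q , constant⇒≡replicate λ i →
                           resolveʳ (λ { refl → ⋖⇒≱ p⋖q (multichain-head (multichain-tail mc) i) })
                                    (values (suc i)))

  inCover⇒coverTail : ∀ {m x} {w : Vec (Fin n) m} → x ≢ 0̂ → InCover (x ∷ w) → CoverTail x w
  inCover⇒coverTail {x = x} {w} x≢0̂ (mc , small) = go small
    where
      nonzero : ∀ i → lookup w i ≢ 0̂
      nonzero i = ≢0̂-upward x≢0̂ (multichain-head mc i)

      go : SmallNonzeroSet (x ∷ w) → CoverTail x w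
      go (inj₁ zeros) = ⊥-elim (x≢0̂ (zeros zero))
      go (inj₂ (inj₁ (p , _ , _ , values))) with resolveʳ x≢0̂ (values zero)
      ... | refl = constant⇒coverTail λ i → resolveʳ (nonzero i) (values (suc i))
      go (inj₂ (inj₂ (p , q , p⋖q , _ , _ , _ , _ , values))) with resolveʳ x≢0̂ (values zero)
      ... | inj₁ refl = twoValued⇒coverTail p⋖q mc λ i → resolveʳ (nonzero i) (values (suc i))
      ... | inj₂ refl = constant⇒coverTail λ i →
            resolveʳ (λ { refl → ⋖⇒≱ p⋖q (multichain-head mc i) })
                     (resolveʳ (nonzero i) (values (suc i)))

  ⋖⇒inCover₂ : ∀ {x y} → x ≢ 0̂ → x ⋖ y → InCover (x ∷ y ∷ [])
  ⋖⇒inCover₂ x≢0̂ x⋖y = coverTail⇒inCover x≢0̂ (inj₂ (x⋖y , refl))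

  module _ {p q₁ q₂ : Fin n} (p≢0̂ : p ≢ 0̂) (p⋖q₁ : p ⋖ q₁) (p⋖q₂ : p ⋖ q₂) where

    private
      Join : Vec (Fin n) 2 → Set
      Join = IsJoin (p ∷ q₁ ∷ []) (p ∷ q₂ ∷ [])

    join-≤-lower-cover : ∀ {c₁ c₂ x} → Join (c₁ ∷ c₂ ∷ []) → p ≤ x → x ⋖ c₂ → c₁ ≤ x
    join-≤-lower-cover {c₂ = c₂} {x} (_ , a≤c , b≤c , least) p≤x x⋖c₂ =
      least (x ∷ c₂ ∷ []) (⋖⇒inCover₂ (≢0̂-upward p≢0̂ p≤x) x⋖c₂)
            (λ { zero → p≤x ; (suc zero) → a≤c (suc zero) })
            (λ { zero → p≤x ; (suc zero) → b≤c (suc zero) })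
            zero

    join-of-covers-not-above : ∀ {c₁ c₂} → Join (c₁ ∷ c₂ ∷ []) → q₁ < c₂ → q₂ < c₂ → ⊥
    join-of-covers-not-above {c₁} {c₂} join@(c∈ , a≤c , b≤c , least) q₁<c₂ q₂<c₂
      with ∃-lower-cover q₁<c₂ | ∃-lower-cover q₂<c₂
         | inCover⇒coverTail (≢0̂-upward p≢0̂ (a≤c zero)) c∈
    ... | x₁ , q₁≤x₁ , x₁⋖c₂ | _ | inj₁ (refl , _) =
      ⋖⇒≱ x₁⋖c₂ (join-≤-lower-cover join (≤.trans (proj₁ (proj₁ p⋖q₁)) q₁≤x₁) x₁⋖c₂)
    ... | x₁ , q₁≤x₁ , x₁⋖c₂ | x₂ , q₂≤x₂ , x₂⋖c₂ | inj₂ (c₁⋖c₂ , _) =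
      ⋖⇒≱ c₁⋖c₂ (least (c₁ ∷ c₁ ∷ [])
                        (coverTail⇒inCover (≢0̂-upward p≢0̂ (a≤c zero)) (inj₁ (refl , tt)))
                        (λ { zero → a≤c zero ; (suc zero) → below-c₁ p⋖q₁ q₁≤x₁ x₁⋖c₂ })
                        (λ { zero → b≤c zero ; (suc zero) → below-c₁ p⋖q₂ q₂≤x₂ x₂⋖c₂ })
                        (suc zero))
      where
        below-c₁ : ∀ {q x} → p ⋖ q → q ≤ x → x ⋖ c₂ → q ≤ c₁
        below-c₁ ((p≤q , _) , _) q≤x x⋖c₂@((x≤c₂ , x≢c₂) , _) = subst (_ ≤_) x≡c₁ q≤x
          where
            c₁≤x = join-≤-lower-cover join (≤.trans p≤q q≤x) x⋖c₂
            x≡c₁ = resolveʳ x≢c₂ (Data.Sum.swap (proj₂ c₁⋖c₂ _ c₁≤x x≤c₂))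

  ⋖-unique : IsLattice {2} → ∀ {p q₁ q₂} → p ≢ 0̂ → p ⋖ q₁ → p ⋖ q₂ → q₁ ≡ q₂
  ⋖-unique lattice {p} {q₁} {q₂} p≢0̂ p⋖q₁ p⋖q₂
    with proj₁ (lattice (p ∷ q₁ ∷ []) (p ∷ q₂ ∷ []) (⋖⇒inCover₂ p≢0̂ p⋖q₁) (⋖⇒inCover₂ p≢0̂ p⋖q₂))
  ... | (c₁ ∷ c₂ ∷ []) , join@(_ , a≤c , b≤c , _) with q₁ ≟ c₂ | q₂ ≟ c₂
  ... | yes refl | _        = sym (⋖-comparable⇒≡ p⋖q₁ p⋖q₂ (b≤c (suc zero)))
  ... | _        | yes refl = ⋖-comparable⇒≡ p⋖q₂ p⋖q₁ (a≤c (suc zero))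
  ... | no q₁≢c₂ | no q₂≢c₂ =
    ⊥-elim (join-of-covers-not-above p≢0̂ p⋖q₁ p⋖q₂ join
              (a≤c (suc zero) , q₁≢c₂) (b≤c (suc zero) , q₂≢c₂))

  CoverChain : ∀ {m} → Vec (Fin n) (suc m) → Set
  CoverChain (p ∷ w) = p ≢ 0̂ × CoverTail p w

  inCover-split : ∀ {m} (v : Vec (Fin n) (suc m)) →
                  ((∃ λ w → InCover w × 0̂ ∷ w ≡ v) ⊎ CoverChain v) ⇔ InCover v
  inCover-split (x ∷ w) = mk⇔ compose decompose
    where
      compose : (∃ λ w′ → InCover w′ × 0̂ ∷ w′ ≡ x ∷ w) ⊎ CoverChain (x ∷ w) → InCover (x ∷ w)
      compose (inj₁ (_ , w∈ , refl)) = from inCover-0̂∷ w∈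
      compose (inj₂ (x≢0̂ , tail))    = coverTail⇒inCover x≢0̂ tail

      decompose : InCover (x ∷ w) → (∃ λ w′ → InCover w′ × 0̂ ∷ w′ ≡ x ∷ w) ⊎ CoverChain (x ∷ w)
      decompose x∷w∈ with x ≟ 0̂
      ... | yes refl = inj₁ (w , to inCover-0̂∷ x∷w∈ , refl)
      ... | no x≢0̂   = inj₂ (x≢0̂ , inCover⇒coverTail x≢0̂ x∷w∈)

[2+m]C2 : ∀ m → suc (suc m) C 2 ≡ suc m + suc m C 2
[2+m]C2 m = trans (sym (nCk+nC[k+1]≡[n+1]C[k+1] (suc m) 1)) (cong (_+ suc m C 2) (nC1≡n (suc m)))

2*[1+m]C2 : ∀ m → 2 * (suc m C 2) ≡ suc m * m
2*[1+m]C2 zero    = refl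
2*[1+m]C2 (suc m) = begin
  2 * (suc (suc m) C 2)          ≡⟨ cong (2 *_) ([2+m]C2 m) ⟩
  2 * (suc m + suc m C 2)        ≡⟨ distrib m (suc m C 2) ⟩
  2 * suc m + 2 * (suc m C 2)    ≡⟨ cong (2 * suc m +_) (2*[1+m]C2 m) ⟩
  2 * suc m + suc m * m          ≡⟨ factor m ⟩
  suc (suc m) * suc m            ∎
  where
    open ≡-Reasoning
    distrib : ∀ m t → 2 * (suc m + t) ≡ 2 * suc m + 2 * t
    distrib = solve-∀
    factor : ∀ m → 2 * suc m + suc m * m ≡ suc (suc m) * suc m
    factor = solve-∀

cover-count-identity : ∀ k m → suc (m + (suc m C 2) * k) + m ^ 2 ≡ suc (suc k) * ((m + 1) C 2) + 1
cover-count-identity k m = begin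
  suc (m + T * k) + m ^ 2          ≡⟨ regroup m k T ⟩
  suc m * m + T * k + 1            ≡⟨ cong (λ s → s + T * k + 1) (2*[1+m]C2 m) ⟨
  2 * T + T * k + 1                ≡⟨ factor k T ⟩
  suc (suc k) * T + 1              ≡⟨ cong (λ i → suc (suc k) * (i C 2) + 1) (+-comm 1 m) ⟩
  suc (suc k) * ((m + 1) C 2) + 1  ∎
  where
    open ≡-Reasoning
    T = suc m C 2
    regroup : ∀ m k t → suc (m + t * k) + m * (m * 1) ≡ suc m * m + t * k + 1
    regroup = solve-∀
    factor : ∀ k t → 2 * t + t * k + 1 ≡ suc (suc k) * t + 1
    factor = solve-∀

module CoverPosetCount {k : ℕ} (P : FinPoset (suc (suc k))) (B : IsBounded P) where
  open FinPoset P
  open IsBounded B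
  open FinPosetCovers P
  open CoverPosetShape P B
  open module CP {m : ℕ} = CoverPoset P B m using (InCover)

  0̂≢1̂ : 0̂ ≢ 1̂
  0̂≢1̂ 0̂≡1̂ = 0≢1+n (trans (≡0̂ zero) (sym (≡0̂ (suc zero))))
    where
      ≡0̂ : ∀ x → x ≡ 0̂
      ≡0̂ x = ≤0̂⇒≡0̂ (subst (x ≤_) (sym 0̂≡1̂) (1̂-great x))

  CoverPair : Fin (suc (suc k)) × Fin (suc (suc k)) → Set
  CoverPair (p , q) = p ≢ 0̂ × p ⋖ q

  duplicateHead : ∀ {m} → Vec (Fin (suc (suc k))) (suc m) → Vec (Fin (suc (suc k))) (suc (suc m))
  duplicateHead (p ∷ w) = p ∷ p ∷ w

  duplicateHead-injective : ∀ {m} {u v : Vec (Fin (suc (suc k))) (suc m)} →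
                            duplicateHead u ≡ duplicateHead v → u ≡ v
  duplicateHead-injective {u = _ ∷ _} {_ ∷ _} refl = refl

  coverVector : ∀ m → Fin (suc (suc k)) × Fin (suc (suc k)) → Vec (Fin (suc (suc k))) (suc (suc m))
  coverVector m (p , q) = p ∷ replicate (suc m) q

  coverVector-injective : ∀ {m pq pq′} → coverVector m pq ≡ coverVector m pq′ → pq ≡ pq′
  coverVector-injective {pq = _ , _} {_ , _} eq =
    cong₂ _,_ (∷-injectiveˡ eq) (∷-injectiveˡ (∷-injectiveʳ eq))

  coverChain-split : ∀ {m} (v : Vec (Fin (suc (suc k))) (suc (suc m))) →
    ((∃ λ u → CoverChain u × duplicateHead u ≡ v) ⊎ (∃ λ pq → CoverPair pq × coverVector m pq ≡ v))
    ⇔ CoverChain v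
  coverChain-split (p ∷ y ∷ w) = mk⇔
    (λ { (inj₁ (_ ∷ _ , (p≢0̂ , tail) , refl)) → p≢0̂ , inj₁ (refl , tail)
       ; (inj₂ (_ , (p≢0̂ , p⋖q) , refl))      → p≢0̂ , inj₂ (p⋖q , refl) })
    (λ { (p≢0̂ , inj₁ (refl , tail)) → inj₁ (p ∷ w , (p≢0̂ , tail) , refl)
       ; (p≢0̂ , inj₂ (p⋖y , refl))  → inj₂ ((p , y) , (p≢0̂ , p⋖y) , refl) })

  module _ (⋖-unique : ∀ {p q₁ q₂} → p ≢ 0̂ → p ⋖ q₁ → p ⋖ q₂ → q₁ ≡ q₂) where

    inner : Fin k → Fin (suc (suc k))
    inner = punchIn₂ 0̂≢1̂

    upper-cover : ∀ j → ∃ λ q → inner j ⋖ q × q ≤ 1̂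
    upper-cover j = ∃-upper-cover (1̂-great (inner j) , punchIn₂≢b 0̂≢1̂ j)

    card-CoverPair : Card CoverPair k
    card-CoverPair =
      card-resp image⇔CoverPair
        (card-image (λ j → inner j , proj₁ (upper-cover j))
                    (punchIn₂-injective 0̂≢1̂ ∘ cong proj₁)
                    (card-Fin k))
      where
        cover-of-inner : ∀ {j q} → inner j ⋖ q → (inner j , proj₁ (upper-cover j)) ≡ (inner j , q)
        cover-of-inner {j} inner⋖q =
          cong (inner j ,_) (⋖-unique (punchIn₂≢a 0̂≢1̂ j) (proj₁ (proj₂ (upper-cover j))) inner⋖q)

        image⇔CoverPair : ∀ pq → (∃ λ j → ⊤ × (inner j , proj₁ (upper-cover j)) ≡ pq) ⇔ CoverPair pq
        image⇔CoverPair (p , q) = mk⇔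
          (λ { (j , _ , refl) → punchIn₂≢a 0̂≢1̂ j , proj₁ (proj₂ (upper-cover j)) })
          (λ (p≢0̂ , p⋖q) → case (punchIn₂-surjective 0̂≢1̂ p≢0̂ (⋖⇒≢1̂ p⋖q)) p⋖q)
          where
            case : (∃ λ j → inner j ≡ p) → p ⋖ q →
                   ∃ λ j → ⊤ × (inner j , proj₁ (upper-cover j)) ≡ (p , q)
            case (j , refl) p⋖q = j , tt , cover-of-inner p⋖q

    card-CoverChain : ∀ m → Card (CoverChain {m}) (m * k + suc k)
    card-CoverChain zero =
      card-resp image⇔CoverChain
        (card-image (λ j → punchIn 0̂ j ∷ []) (punchIn-injective 0̂ _ _ ∘ ∷-injectiveˡ)
                    (card-Fin (suc k)))
      where
        image⇔CoverChain : ∀ v → (∃ λ j → ⊤ × punchIn 0̂ j ∷ [] ≡ v) ⇔ CoverChain v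
        image⇔CoverChain (_ ∷ []) = mk⇔
          (λ { (j , _ , refl) → punchInᵢ≢i 0̂ j , tt })
          (λ (p≢0̂ , _) → punchOut (p≢0̂ ∘ sym) , tt , cong (_∷ []) (punchIn-punchOut _))
    card-CoverChain (suc m) =
      subst (Card CoverChain) (step m k)
        (card-resp coverChain-split
          (card-⊎ disjoint
            (card-image duplicateHead duplicateHead-injective (card-CoverChain m))
            (card-image (coverVector m) coverVector-injective card-CoverPair)))
      where
        disjoint : ∀ v → (∃ λ u → CoverChain u × duplicateHead u ≡ v) →
                   (∃ λ pq → CoverPair pq × coverVector m pq ≡ v) → ⊥
        disjoint _ (_ ∷ _ , _ , refl) (_ , (_ , p⋖q) , refl) = proj₂ (proj₁ p⋖q) refl

        step : ∀ m k → m * k + suc k + k ≡ suc m * k + suc k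
        step = solve-∀

    card-InCover : ∀ m → Card (InCover {m}) (suc (m + (suc m C 2) * k))
    card-InCover zero =
      card-resp (λ { [] → mk⇔ (λ _ → (λ ()) , inj₁ (λ ())) (λ _ → refl) }) (card-singleton [])
    card-InCover (suc m) =
      subst (Card InCover) count
        (card-resp inCover-split
          (card-⊎ disjoint
            (card-image (0̂ ∷_) ∷-injectiveʳ (card-InCover m))
            (card-CoverChain m)))
      where
        disjoint : ∀ v → (∃ λ w → InCover w × 0̂ ∷ w ≡ v) → CoverChain v → ⊥
        disjoint _ (_ , _ , refl) (0̂≢0̂ , _) = 0̂≢0̂ refl

        open ≡-Reasoning
        count : suc (m + (suc m C 2) * k) + (m * k + suc k) ≡ suc (suc m + (suc (suc m) C 2) * k)
        count = begin
          suc (m + (suc m C 2) * k) + (m * k + suc k)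
            ≡⟨ regroup m k (suc m C 2) ⟩
          suc (suc m + (suc m + suc m C 2) * k)
            ≡⟨ cong (λ t → suc (suc m + t * k)) ([2+m]C2 m) ⟨
          suc (suc m + (suc (suc m) C 2) * k)
            ∎
          where
            regroup : ∀ m k t → suc (m + t * k) + (m * k + suc k) ≡ suc (suc m + (suc m + t) * k)
            regroup = solve-∀

open import Data.Nat using (_<_)

proposition2p8 : (n : ℕ) (P : FinPoset n) (B : IsBounded P) →
    (∀ (m : ℕ) → 0 < m → CoverPoset.IsLattice P B m) →
    1 < n →
    ∀ (m : ℕ) → 0 < m →
      ∃ λ (k : ℕ) → CoverPoset.HasCardinality P B m k × (k + m ^ 2 ≡ n * ((m + 1) C 2) + 1)
proposition2p8 (suc (suc k)) P B lattice (s≤s (s≤s z≤n)) m _ =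
  _ , card-InCover (⋖-unique (lattice 2 (s≤s z≤n))) m , cover-count-identity k m
  where
    open CoverPosetShape P B using (⋖-unique)
    open CoverPosetCount P B using (card-InCover)
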